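{- Let $H$ and $K$ be subgroups of a group such that $HK$ is a group and $H\cap K=\{1\}$, and let $HK$ act faithfully on a set $X$, with its subgroups acting by restriction. Then $D_{HK,H}(X)\geq D_K(X)$.
   Context: An $r$-labeling of $X$ is a surjection $\phi:X\to\{1,\ldots,r\}$; $g$ preserves $\phi$ if $\phi(g.x)=\phi(x)$ for all $x\in X$. For a group $\Gamma$ acting on $X$ and $L\leqslant\Gamma$, $D_{\Gamma,L}(X)$ is the smallest $r$ such that there is an $r$-labeling of $X$ all of whose preserving elements of $\Gamma$ lie in $L$. $D_K(X)$ is the distinguishing number of $X$ under $K$: the least $r$ admitting an $r$-labeling preserved by no nonidentity element of $K$. -}

module Defs where

open import Level using (Level; _⊔_)
open import Algebra.Bundles using (Group)
open import Data.Nat using (ℕ; _<_)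
open import Data.Fin using (Fin)
open import Data.Product using (Σ; ∃; ∃-syntax; _×_; _,_)
open import Function.Definitions using (Surjective)
open import Relation.Binary.PropositionalEquality using (_≡_)
open import Relation.Nullary using (¬_)
open import Relation.Unary using (Pred)

module _ {c ℓ : Level} (G : Group c ℓ) where
  open Group G

  record IsSubgroup {ℓ₁ : Level} (S : Pred Carrier ℓ₁) : Set (c ⊔ ℓ ⊔ ℓ₁) where
    field
      resp  : ∀ {g h} → g ≈ h → S g → S h
      ε∈    : S ε
      ∙∈    : ∀ {g h} → S g → S h → S (g ∙ h)
      ⁻¹∈   : ∀ {g} → S g → S (g ⁻¹)

  Prod : {ℓ₁ ℓ₂ : Level} → Pred Carrier ℓ₁ → Pred Carrier ℓ₂ → Pred Carrier (c ⊔ ℓ ⊔ ℓ₁ ⊔ ℓ₂)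
  Prod H K g = ∃[ h ] ∃[ k ] (H h × K k × g ≈ h ∙ k)

  TrivialIntersection : {ℓ₁ ℓ₂ : Level} → Pred Carrier ℓ₁ → Pred Carrier ℓ₂ → Set (c ⊔ ℓ ⊔ ℓ₁ ⊔ ℓ₂)
  TrivialIntersection H K = ∀ g → H g → K g → g ≈ ε

  record Action {ℓ₁ ℓ₂ : Level} (S : Pred Carrier ℓ₁) (X : Set ℓ₂) : Set (c ⊔ ℓ ⊔ ℓ₁ ⊔ ℓ₂) where
    field
      act    : (g : Carrier) → S g → X → X
      act-ε  : ∀ (p : S ε) x → act ε p x ≡ x
      act-∙  : ∀ g h (p : S g) (q : S h) (r : S (g ∙ h)) x →
               act (g ∙ h) r x ≡ act g p (act h q x)
      act-cong : ∀ {g h} (p : S g) (q : S h) → g ≈ h → ∀ x → act g p x ≡ act h q x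

  module _ {ℓ₁ ℓ₂ : Level} {S : Pred Carrier ℓ₁} {X : Set ℓ₂} (A : Action S X) where
    open Action A

    Faithful : Set (c ⊔ ℓ ⊔ ℓ₁ ⊔ ℓ₂)
    Faithful = ∀ g (p : S g) → (∀ x → act g p x ≡ x) → g ≈ ε

    -- an r-labeling: a surjection X → {1,…,r} (labels modelled by Fin r)
    Labeling : ℕ → Set ℓ₂
    Labeling r = Σ (X → Fin r) Surjective′
      where
      Surjective′ : (X → Fin r) → Set ℓ₂
      Surjective′ φ = Surjective _≡_ _≡_ φ

    Preserves : ∀ {r} (g : Carrier) → S g → (X → Fin r) → Set ℓ₂
    Preserves g p φ = ∀ x → φ (act g p x) ≡ φ x

    -- Subgroups T ⊆ S act by restriction, via the inclusion `inc`.
    module _ {ℓ₃ : Level} {T : Pred Carrier ℓ₃} (inc : ∀ {g} → T g → S g) where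

      PreservedIn : ∀ {ℓ₄ r} → Pred Carrier ℓ₄ → Labeling r → Set (c ⊔ ℓ₂ ⊔ ℓ₃ ⊔ ℓ₄)
      PreservedIn L (φ , _) = ∀ g (t : T g) → Preserves g (inc t) φ → L g

      -- D_{T,L}(X) = d : d is the least r admitting an r-labeling all of whose
      -- preserving elements of T lie in L
      IsRelDistNum : ∀ {ℓ₄} → Pred Carrier ℓ₄ → ℕ → Set (c ⊔ ℓ₂ ⊔ ℓ₃ ⊔ ℓ₄)
      IsRelDistNum {ℓ₄} L d =
        (Σ (Labeling d) (PreservedIn L)) ×
        (∀ r → r < d → ¬ Σ (Labeling r) (PreservedIn L))

      Distinguishing : ∀ {r} → Labeling r → Set (c ⊔ ℓ ⊔ ℓ₂ ⊔ ℓ₃)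
      Distinguishing (φ , _) = ∀ g (t : T g) → Preserves g (inc t) φ → g ≈ ε

      -- D_T(X) = d : d is the least r admitting a distinguishing r-labeling
      IsDistNum : ℕ → Set (c ⊔ ℓ ⊔ ℓ₂ ⊔ ℓ₃)
      IsDistNum d =
        (Σ (Labeling d) Distinguishing) ×
        (∀ r → r < d → ¬ Σ (Labeling r) Distinguishing)

  K⊆HK : {ℓ₁ ℓ₂ : Level} {H : Pred Carrier ℓ₁} {K : Pred Carrier ℓ₂} →
         IsSubgroup H → ∀ {g} → K g → Prod H K g
  K⊆HK sH {g} k = ε , g , IsSubgroup.ε∈ sH , k , sym (identityˡ g)

-- A labeling all of whose preservers in HK lie in H is already distinguishing
-- for K: a preserver in K lies in H ∩ K = {1}.  So a witness for D_{HK,H}(X)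
-- is a witness for D_K(X), and minimality of D_K(X) gives the inequality.
module Submission where

open import Defs
open import Level using (Level)
open import Algebra.Bundles using (Group)
open import Data.Nat using (ℕ; _≤_; _<_)
open import Data.Nat.Properties using (≮⇒≥)
open import Data.Product using (Σ; _,_)
open import Relation.Nullary using (¬_)
open import Relation.Unary using (Pred)
open import Function using (id)

≤-of-least : ∀ {a} (P : ℕ → Set a) {d r} →
             (∀ s → s < d → ¬ P s) → P r → d ≤ r
≤-of-least P least pr = ≮⇒≥ λ r<d → least _ r<d pr

module _ {c ℓ ℓ₁ ℓ₂ ℓ₃ : Level} (G : Group c ℓ)
         {H : Pred (Group.Carrier G) ℓ₁} {K : Pred (Group.Carrier G) ℓ₂}
         (sH : IsSubgroup G H) (triv : TrivialIntersection G H K)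
         {X : Set ℓ₃} (A : Action G (Prod G H K) X) where

  preservedInH⇒distinguishingK : ∀ {r} (φ : Labeling G A r) →
    PreservedIn G A {T = Prod G H K} id H φ →
    Distinguishing G A {T = K} (K⊆HK G sH) φ
  preservedInH⇒distinguishingK φ pres g k preserves =
    triv g (pres g (K⊆HK G sH k) preserves) k

mainTheorem17 : {c ℓ ℓ₁ ℓ₂ ℓ₃ : Level} (G : Group c ℓ)
    (H : Pred (Group.Carrier G) ℓ₁) (K : Pred (Group.Carrier G) ℓ₂)
    (sH : IsSubgroup G H) (sK : IsSubgroup G K)
    (sHK : IsSubgroup G (Prod G H K)) →
    TrivialIntersection G H K →
    (X : Set ℓ₃) (A : Action G (Prod G H K) X) → Faithful G A →
    (d₁ d₂ : ℕ) →
    IsRelDistNum G A {T = Prod G H K} id H d₁ →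
    IsDistNum G A {T = K} (K⊆HK G sH) d₂ →
    d₂ ≤ d₁
mainTheorem17 G H K sH _ _ triv X A _ d₁ d₂ ((φ , pres) , _) (_ , leastK) =
  ≤-of-least (λ r → Σ (Labeling G A r) (Distinguishing G A (K⊆HK G sH)))
    leastK (φ , preservedInH⇒distinguishingK G sH triv A φ pres)
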